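{- Let $q$ be a prime power, $n$ a positive integer and $F=\mathbb{F}_{q^{2n+1}}$. Consider the projective space $\mathrm{PG}(4n+1,q)$ whose points are the $1$-dimensional $\mathbb{F}_q$-subspaces of the $\mathbb{F}_q$-vector space $F\times F$; write $P(a,b)$ for the point spanned by $(a,b)\ne(0,0)$. Let $\Pi_1=\{P(0,b):b\in F^*\}$, $\Pi_2=\{P(a,0):a\in F^*\}$ and, for $\omega\in F^*$, $\mathcal{V}_\omega=\{P(x^2,\omega x^{q+1}):x\in F^*\}$. Then the sets $\mathcal{V}_\omega$, $\omega\in F^*$, are pairwise disjoint and their union is the set of points of $\mathrm{PG}(4n+1,q)$ not in $\Pi_1\cup\Pi_2$. -}

module Defs where

open import Level using (Level; _⊔_) renaming (suc to lsuc)
open import Data.Nat using (ℕ; zero; suc; _≥_; _^_)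
open import Data.Nat.Primality using (Prime)
open import Data.Fin using (Fin)
open import Data.Product using (Σ; _×_; _,_; ∃; ∃-syntax; proj₁; proj₂)
open import Relation.Nullary using (¬_)
open import Relation.Binary.PropositionalEquality using (_≡_)
open import Relation.Binary.PropositionalEquality.Properties using () renaming (setoid to ≡-setoid)
open import Function.Bundles using (Bijection; _⇔_)
open import Algebra.Bundles using (CommutativeRing)

IsPrimePower : ℕ → Set
IsPrimePower q = Σ ℕ λ p → Σ ℕ λ k → Prime p × k ≥ 1 × q ≡ p ^ k

record Field (c ℓ : Level) : Set (lsuc (c ⊔ ℓ)) where
  field
    commutativeRing : CommutativeRing c ℓ
  open CommutativeRing commutativeRing public
  field
    0≉1     : ¬ (0# ≈ 1#)
    inverse : ∀ x → ¬ (x ≈ 0#) → ∃[ y ] (x * y ≈ 1#)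

module FieldOps {c ℓ} (F : Field c ℓ) where
  open Field F

  _^ᶠ_ : Carrier → ℕ → Carrier
  x ^ᶠ zero  = 1#
  x ^ᶠ suc m = x * (x ^ᶠ m)

HasCard : ∀ {c ℓ} → Field c ℓ → ℕ → Set (c ⊔ ℓ)
HasCard F N = Bijection (Field.setoid F) (≡-setoid (Fin N))

-- The projective space PG(F × F) over the subfield F_q = { λ ∈ F | λ^q = λ }
module PG {c ℓ} (F : Field c ℓ) (q : ℕ) where
  open Field F
  open FieldOps F

  InFq : Carrier → Set ℓ
  InFq λ₀ = λ₀ ^ᶠ q ≈ λ₀

  -- a nonzero vector (a , b) of F × F; P(a,b) is the point it spans
  record Vec≠0 : Set (c ⊔ ℓ) where
    constructor P
    field
      fst    : Carrier
      snd    : Carrier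
      nonzero : ¬ (fst ≈ 0# × snd ≈ 0#)

  SamePoint : Vec≠0 → Vec≠0 → Set (c ⊔ ℓ)
  SamePoint u v = ∃[ λ₀ ] (InFq λ₀ × ¬ (λ₀ ≈ 0#)
                  × Vec≠0.fst v ≈ λ₀ * Vec≠0.fst u × Vec≠0.snd v ≈ λ₀ * Vec≠0.snd u)

  InΠ₁ : Vec≠0 → Set (c ⊔ ℓ)
  InΠ₁ u = ∃[ b ] Σ (¬ (b ≈ 0#)) λ b≠0 →
             SamePoint u (P 0# b (λ { (_ , b≈0) → b≠0 b≈0 }))

  InΠ₂ : Vec≠0 → Set (c ⊔ ℓ)
  InΠ₂ u = ∃[ a ] Σ (¬ (a ≈ 0#)) λ a≠0 →
             SamePoint u (P a 0# (λ { (a≈0 , _) → a≠0 a≈0 }))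

  vω : (ω x : Carrier) → ¬ (x ≈ 0#) → Vec≠0
  vω ω x x≠0 = P (x ^ᶠ 2) (ω * (x ^ᶠ (suc q))) nz
    where
    nz : ¬ ((x ^ᶠ 2) ≈ 0# × (ω * (x ^ᶠ suc q)) ≈ 0#)
    nz (x²≈0 , _) with inverse x x≠0
    ... | (y , xy≈1) = 0≉1 (trans (sym (zeroˡ (y * y)))
          (trans (*-cong (sym x²≈0) refl)
          (trans (*-cong (*-congˡ (*-identityʳ x)) refl)
          (trans (*-cong (*-comm x x) refl)
          (trans (*-assoc x x (y * y))
          (trans (*-congˡ (trans (sym (*-assoc x y y)) (trans (*-cong xy≈1 refl) (*-identityˡ y))))
          xy≈1))))))

  InV : Carrier → Vec≠0 → Set (c ⊔ ℓ)
  InV ω u = ∃[ x ] Σ (¬ (x ≈ 0#)) λ x≠0 → SamePoint u (vω ω x x≠0)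

  Conclusion : Set (c ⊔ ℓ)
  Conclusion =
    ((ω ω′ : Carrier) → ¬ (ω ≈ 0#) → ¬ (ω′ ≈ 0#) →
       (u : Vec≠0) → InV ω u → InV ω′ u → ω ≈ ω′)
    × ((u : Vec≠0) →
       (∃[ ω ] (¬ (ω ≈ 0#) × InV ω u)) ⇔ (¬ InΠ₁ u × ¬ InΠ₂ u))

{-# OPTIONS --safe #-}
module Submission where

-- Let Q = q^(2n+1) = 1 + (q − 1)N, where N = 1 + q + ⋯ + q^(2n) is odd. Fermat's little
-- theorem a^(Q−1) = 1 puts the norm a^N of every a ∈ F* into F_q, and a · a^N = (a^((N+1)/2))²,
-- so every a ∈ F* is a square up to a factor in F_q*; this gives each point P(a,b) with ab ≠ 0
-- a representative (x², ω x^(q+1)). Conversely, if t² ∈ F_q then s = t^(q−1) satisfies s² = 1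
-- and s^N = 1, so s = 1 because N is odd, i.e. t^(q+1) = t². Applied to the ratio t = x/y of two
-- representatives of the same point, this shows that ω is determined by the point.

open import Defs
open import Level using (Level; _⊔_)
open import Data.Nat using (ℕ; zero; suc; _≥_; _+_; _*_; _^_)
import Data.Nat.Properties as ℕ
open import Data.Nat.Tactic.RingSolver using (solve-∀; solve)
open import Data.Fin as Fin using (Fin; punchIn)
open import Data.Fin.Properties using (¬Fin0; punchInᵢ≢i)
open import Data.Fin.Permutation using (Permutation; permutation; remove; _⟨$⟩ʳ_; punchIn-permute)
open import Data.List using (_∷_; [])
open import Data.Vec.Functional using (replicate)
open import Data.Product using (_×_; _,_; ∃-syntax)
open import Data.Empty using (⊥-elim)
open import Relation.Nullary using (¬_)
open import Relation.Binary.PropositionalEquality as ≡ using (_≡_)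
open import Function.Bundles using (Bijection; Inverse; _⇔_; mk⇔)
open import Function.Base using (_∘_)
open import Function.Properties.Bijection using (Bijection⇒Inverse)
import Algebra.Properties.CommutativeSemiring.Exp as Exp
import Algebra.Properties.CommutativeMonoid.Sum as Product
import Algebra.Solver.CommutativeMonoid as CommutativeMonoidSolver

repunit : ℕ → ℕ → ℕ
repunit q zero    = zero
repunit q (suc k) = suc (q * repunit q k)

repunit-geometric : ∀ q k → suc (q * repunit (suc q) k) ≡ suc q ^ k
repunit-geometric q zero    = ≡.cong suc (ℕ.*-zeroʳ q)
repunit-geometric q (suc k) = begin
  suc (q * suc (suc q * r))  ≡⟨ rearrange q r ⟩
  suc q * suc (q * r)        ≡⟨ ≡.cong (suc q *_) (repunit-geometric q k) ⟩
  suc q * suc q ^ k          ∎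
  where
  open ≡.≡-Reasoning
  r : ℕ
  r = repunit (suc q) k
  rearrange : ∀ q r → suc (q * suc (suc q * r)) ≡ suc q * suc (q * r)
  rearrange = solve-∀

n*[1+n]-even : ∀ n → ∃[ t ] n * suc n ≡ 2 * t
n*[1+n]-even zero    = 0 , ≡.refl
n*[1+n]-even (suc n) with n*[1+n]-even n
... | t , n*[1+n]≡2t = t + suc n , (begin
  suc n * suc (suc n)    ≡⟨ solve (n ∷ []) ⟩
  n * suc n + 2 * suc n  ≡⟨ ≡.cong (_+ 2 * suc n) n*[1+n]≡2t ⟩
  2 * t + 2 * suc n      ≡⟨ solve (t ∷ n ∷ []) ⟩
  2 * (t + suc n)        ∎)
  where open ≡.≡-Reasoning

repunit-odd : ∀ q j → ∃[ m ] repunit q (2 * j + 1) ≡ 2 * m + 1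
repunit-odd q zero    = 0 , ≡.cong suc (ℕ.*-zeroʳ q)
repunit-odd q (suc j) with repunit-odd q j | n*[1+n]-even q
... | m , r≡2m+1 | t , q*[1+q]≡2t = t + q * q * m , (begin
  repunit q (2 * suc j + 1)        ≡⟨ ≡.cong (repunit q) (solve (j ∷ [])) ⟩
  suc (q * suc (q * r))            ≡⟨ ≡.cong (λ r → suc (q * suc (q * r))) r≡2m+1 ⟩
  suc (q * suc (q * (2 * m + 1)))  ≡⟨ solve (q ∷ m ∷ []) ⟩
  q * suc q + 2 * (q * q * m) + 1  ≡⟨ ≡.cong (λ s → s + 2 * (q * q * m) + 1) q*[1+q]≡2t ⟩
  2 * t + 2 * (q * q * m) + 1      ≡⟨ solve (t ∷ q ∷ m ∷ []) ⟩
  2 * (t + q * q * m) + 1          ∎)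
  where
  open ≡.≡-Reasoning
  r : ℕ
  r = repunit q (2 * j + 1)

module FieldProperties {c ℓ} (F : Field c ℓ) where
  open Field F hiding (_+_) renaming (_*_ to _·_)
  open FieldOps F
  open Exp commutativeSemiring using (^-homo-*; ^-assocʳ; ^-distrib-*; ^-congˡ)
    renaming (_^_ to _^ʳ_)
  open Product *-commutativeMonoid
    using (sum-permute; ∑-distrib-+; sum-replicate; sum-cong-≋) renaming (sum to product)
  open import Relation.Binary.Reasoning.Setoid setoid

  1≉0 : 1# ≉ 0#
  1≉0 1≈0 = 0≉1 (sym 1≈0)

  ·-cancelˡ : ∀ {x y z} → x ≉ 0# → x · y ≈ x · z → y ≈ z
  ·-cancelˡ {x} {y} {z} x≉0 xy≈xz with inverse x x≉0
  ... | x⁻¹ , xx⁻¹≈1 = begin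
    y              ≈⟨ *-identityˡ y ⟨
    1# · y         ≈⟨ *-congʳ x⁻¹x≈1 ⟨
    (x⁻¹ · x) · y  ≈⟨ *-assoc x⁻¹ x y ⟩
    x⁻¹ · (x · y)  ≈⟨ *-congˡ xy≈xz ⟩
    x⁻¹ · (x · z)  ≈⟨ *-assoc x⁻¹ x z ⟨
    (x⁻¹ · x) · z  ≈⟨ *-congʳ x⁻¹x≈1 ⟩
    1# · z         ≈⟨ *-identityˡ z ⟩
    z              ∎
    where
    x⁻¹x≈1 : x⁻¹ · x ≈ 1#
    x⁻¹x≈1 = trans (*-comm x⁻¹ x) xx⁻¹≈1

  ·-cancelʳ : ∀ {x y z} → x ≉ 0# → y · x ≈ z · x → y ≈ z
  ·-cancelʳ {x} {y} {z} x≉0 yx≈zx =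
    ·-cancelˡ x≉0 (trans (*-comm x y) (trans yx≈zx (*-comm z x)))

  x·y≈0⇒y≈0 : ∀ {x y} → x ≉ 0# → x · y ≈ 0# → y ≈ 0#
  x·y≈0⇒y≈0 {x} x≉0 xy≈0 = ·-cancelˡ x≉0 (trans xy≈0 (sym (zeroʳ x)))

  ·-nonzero : ∀ {x y} → x ≉ 0# → y ≉ 0# → x · y ≉ 0#
  ·-nonzero x≉0 y≉0 xy≈0 = y≉0 (x·y≈0⇒y≈0 x≉0 xy≈0)

  x·y≈1⇒y≉0 : ∀ {x y} → x · y ≈ 1# → y ≉ 0#
  x·y≈1⇒y≉0 {x} xy≈1 y≈0 = 1≉0 (trans (sym xy≈1) (trans (*-congˡ y≈0) (zeroʳ x)))

  product-nonzero : ∀ {n} (f : Fin n → Carrier) → (∀ i → f i ≉ 0#) → product f ≉ 0#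
  product-nonzero {zero}  f f≉0 = 1≉0
  product-nonzero {suc n} f f≉0 =
    ·-nonzero (f≉0 Fin.zero) (product-nonzero (λ i → f (Fin.suc i)) (λ i → f≉0 (Fin.suc i)))

  ^ᶠ≡^ : ∀ x n → x ^ᶠ n ≡ x ^ʳ n
  ^ᶠ≡^ x zero    = ≡.refl
  ^ᶠ≡^ x (suc n) = ≡.cong (x ·_) (^ᶠ≡^ x n)

  ^ᶠ-congˡ : ∀ {x y} n → x ≈ y → x ^ᶠ n ≈ y ^ᶠ n
  ^ᶠ-congˡ {x} {y} n x≈y rewrite ^ᶠ≡^ x n | ^ᶠ≡^ y n = ^-congˡ n x≈y

  ^ᶠ-homo-· : ∀ x m n → x ^ᶠ (m + n) ≈ x ^ᶠ m · x ^ᶠ n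
  ^ᶠ-homo-· x m n rewrite ^ᶠ≡^ x (m + n) | ^ᶠ≡^ x m | ^ᶠ≡^ x n = ^-homo-* x m n

  ^ᶠ-assocʳ : ∀ x m n → (x ^ᶠ m) ^ᶠ n ≈ x ^ᶠ (m * n)
  ^ᶠ-assocʳ x m n rewrite ^ᶠ≡^ (x ^ᶠ m) n | ^ᶠ≡^ x m | ^ᶠ≡^ x (m * n) = ^-assocʳ x m n

  ^ᶠ-distrib-· : ∀ x y n → (x · y) ^ᶠ n ≈ x ^ᶠ n · y ^ᶠ n
  ^ᶠ-distrib-· x y n rewrite ^ᶠ≡^ (x · y) n | ^ᶠ≡^ x n | ^ᶠ≡^ y n = ^-distrib-* x y n

  1^ᶠn≈1 : ∀ n → 1# ^ᶠ n ≈ 1#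
  1^ᶠn≈1 zero    = refl
  1^ᶠn≈1 (suc n) = trans (*-identityˡ _) (1^ᶠn≈1 n)

  ^ᶠ-nonzero : ∀ {x} n → x ≉ 0# → x ^ᶠ n ≉ 0#
  ^ᶠ-nonzero zero    x≉0 = 1≉0
  ^ᶠ-nonzero (suc n) x≉0 = ·-nonzero x≉0 (^ᶠ-nonzero n x≉0)

  x²≈1⇒x^[2m+1]≈x : ∀ {x} m → x ^ᶠ 2 ≈ 1# → x ^ᶠ (2 * m + 1) ≈ x
  x²≈1⇒x^[2m+1]≈x {x} m x²≈1 = begin
    x ^ᶠ (2 * m + 1)         ≈⟨ ^ᶠ-homo-· x (2 * m) 1 ⟩
    x ^ᶠ (2 * m) · (x · 1#)  ≈⟨ *-cong (sym (^ᶠ-assocʳ x 2 m)) (*-identityʳ x) ⟩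
    (x ^ᶠ 2) ^ᶠ m · x        ≈⟨ *-congʳ (trans (^ᶠ-congˡ m x²≈1) (1^ᶠn≈1 m)) ⟩
    1# · x                   ≈⟨ *-identityˡ x ⟩
    x                        ∎

  -- F* is enumerated by v = from ∘ punchIn (to 0#); multiplication by a fixes to 0#, so it
  -- restricts to a permutation ρ of Fin M, and ∏ v = ∏ (v ∘ ρ) = a^M ∏ v.
  fermat : ∀ {M} → HasCard F (suc M) → ∀ {a} → a ≉ 0# → a ^ᶠ M ≈ 1#
  fermat {M} card {a} a≉0 with inverse a a≉0
  ... | a⁻¹ , aa⁻¹≈1 = ·-cancelʳ (product-nonzero v v≉0) (begin
    a ^ᶠ M · product v                  ≈⟨ *-congʳ (reflexive (^ᶠ≡^ a M)) ⟩
    a ^ʳ M · product v                  ≈⟨ *-congʳ (sum-replicate M) ⟨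
    product (replicate M a) · product v ≈⟨ ∑-distrib-+ (replicate M a) v ⟨
    product (λ j → a · v j)             ≈⟨ sum-cong-≋ v∘ρ≈a·v ⟨
    product (λ j → v (ρ ⟨$⟩ʳ j))        ≈⟨ sum-permute v ρ ⟨
    product v                           ≈⟨ *-identityˡ _ ⟨
    1# · product v                      ∎)
    where
    open Inverse (Bijection⇒Inverse card)

    scale : Carrier → Fin (suc M) → Fin (suc M)
    scale x i = to (x · from i)

    scale-inverse : ∀ {x y} → x · y ≈ 1# → ∀ i → scale x (scale y i) ≡ i
    scale-inverse {x} {y} xy≈1 i = ≡.trans (to-cong (begin
      x · from (to (y · from i))  ≈⟨ *-congˡ (strictlyInverseʳ _) ⟩
      x · (y · from i)            ≈⟨ *-assoc x y _ ⟨
      (x · y) · from i            ≈⟨ *-congʳ xy≈1 ⟩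
      1# · from i                 ≈⟨ *-identityˡ _ ⟩
      from i                      ∎)) (strictlyInverseˡ i)

    z : Fin (suc M)
    z = to 0#

    scale-z : ∀ x → scale x z ≡ z
    scale-z x = to-cong (trans (*-congˡ (strictlyInverseʳ 0#)) (zeroʳ x))

    π : Permutation (suc M) (suc M)
    π = permutation (scale a) (scale a⁻¹)
          (scale-inverse aa⁻¹≈1) (scale-inverse (trans (*-comm a⁻¹ a) aa⁻¹≈1))

    ρ : Permutation M M
    ρ = remove z π

    v : Fin M → Carrier
    v j = from (punchIn z j)

    v≉0 : ∀ j → v j ≉ 0#
    v≉0 j vj≈0 = punchInᵢ≢i z j (≡.trans (≡.sym (strictlyInverseˡ _)) (to-cong vj≈0))

    v∘ρ≈a·v : ∀ j → v (ρ ⟨$⟩ʳ j) ≈ a · v j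
    v∘ρ≈a·v j = begin
      from (punchIn z (ρ ⟨$⟩ʳ j))            ≡⟨ ≡.cong (λ k → from (punchIn k (ρ ⟨$⟩ʳ j))) (scale-z a) ⟨
      from (punchIn (scale a z) (ρ ⟨$⟩ʳ j))  ≡⟨ ≡.cong from (punchIn-permute π z j) ⟨
      from (scale a (punchIn z j))           ≈⟨ strictlyInverseʳ _ ⟩
      a · v j                                ∎

module Partition {c ℓ} (F : Field c ℓ) (q : ℕ) where
  open Field F hiding (_+_) renaming (_*_ to _·_)
  open FieldOps F
  open FieldProperties F
  open PG F q
  open CommutativeMonoidSolver *-commutativeMonoid using (_⊕_; _⊜_) renaming (solve to ·-solve)
  open import Relation.Binary.Reasoning.Setoid setoid

  1∈Fq : InFq 1#
  1∈Fq = 1^ᶠn≈1 q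

  InFq-resp : ∀ {x y} → x ≈ y → InFq x → InFq y
  InFq-resp {x} {y} x≈y x∈Fq = trans (^ᶠ-congˡ q (sym x≈y)) (trans x∈Fq x≈y)

  InFq-cancelʳ : ∀ {s μ} → InFq μ → μ ≉ 0# → InFq (s · μ) → InFq s
  InFq-cancelʳ {s} {μ} μ∈Fq μ≉0 sμ∈Fq = ·-cancelʳ μ≉0 (begin
    s ^ᶠ q · μ       ≈⟨ *-congˡ μ∈Fq ⟨
    s ^ᶠ q · μ ^ᶠ q  ≈⟨ ^ᶠ-distrib-· s μ q ⟨
    (s · μ) ^ᶠ q     ≈⟨ sμ∈Fq ⟩
    s · μ            ∎)

  InΠ₁⇒fst≈0 : ∀ u → InΠ₁ u → Vec≠0.fst u ≈ 0#
  InΠ₁⇒fst≈0 _ (_ , _ , ν , _ , ν≉0 , 0≈νa , _) = x·y≈0⇒y≈0 ν≉0 (sym 0≈νa)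

  InΠ₂⇒snd≈0 : ∀ u → InΠ₂ u → Vec≠0.snd u ≈ 0#
  InΠ₂⇒snd≈0 _ (_ , _ , ν , _ , ν≉0 , _ , 0≈νb) = x·y≈0⇒y≈0 ν≉0 (sym 0≈νb)

  fst≈0⇒InΠ₁ : ∀ u → Vec≠0.fst u ≈ 0# → InΠ₁ u
  fst≈0⇒InΠ₁ (P a b nz) a≈0 =
    b , b≉0 , 1# , 1∈Fq , 1≉0 , sym (trans (*-identityˡ a) a≈0) , sym (*-identityˡ b)
    where
    b≉0 : b ≉ 0#
    b≉0 b≈0 = nz (a≈0 , b≈0)

  snd≈0⇒InΠ₂ : ∀ u → Vec≠0.snd u ≈ 0# → InΠ₂ u
  snd≈0⇒InΠ₂ (P a b nz) b≈0 =
    a , a≉0 , 1# , 1∈Fq , 1≉0 , sym (*-identityˡ a) , sym (trans (*-identityˡ b) b≈0)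
    where
    a≉0 : a ≉ 0#
    a≉0 a≈0 = nz (a≈0 , b≈0)

  InV⇒fst≉0 : ∀ {ω} u → InV ω u → Vec≠0.fst u ≉ 0#
  InV⇒fst≉0 _ (x , x≉0 , λ₀ , _ , _ , x²≈λa , _) a≈0 =
    ^ᶠ-nonzero 2 x≉0 (trans x²≈λa (trans (*-congˡ a≈0) (zeroʳ λ₀)))

  InV⇒snd≉0 : ∀ {ω} u → ω ≉ 0# → InV ω u → Vec≠0.snd u ≉ 0#
  InV⇒snd≉0 _ ω≉0 (x , x≉0 , λ₀ , _ , _ , _ , ωx^[q+1]≈λb) b≈0 =
    ·-nonzero ω≉0 (^ᶠ-nonzero (suc q) x≉0) (trans ωx^[q+1]≈λb (trans (*-congˡ b≈0) (zeroʳ λ₀)))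

  ScaledSquare : Carrier → Set (c ⊔ ℓ)
  ScaledSquare a = ∃[ x ] ∃[ λ₀ ] (x ≉ 0# × InFq λ₀ × λ₀ ≉ 0# × x ^ᶠ 2 ≈ λ₀ · a)

  nonzero-coords⇒InV : (∀ {a} → a ≉ 0# → ScaledSquare a) →
    ∀ u → Vec≠0.fst u ≉ 0# → Vec≠0.snd u ≉ 0# → ∃[ ω ] (ω ≉ 0# × InV ω u)
  nonzero-coords⇒InV scaled-square (P a b _) a≉0 b≉0
    with scaled-square a≉0
  ... | x , λ₀ , x≉0 , λ∈Fq , λ≉0 , x²≈λa
    with inverse (x ^ᶠ suc q) (^ᶠ-nonzero (suc q) x≉0)
  ... | X⁻¹ , XX⁻¹≈1 =
    ω , ·-nonzero (·-nonzero λ≉0 b≉0) (x·y≈1⇒y≉0 XX⁻¹≈1) , x , x≉0 , λ₀ , λ∈Fq , λ≉0 , x²≈λa , ωX≈λb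
    where
    X : Carrier
    X = x ^ᶠ suc q
    ω : Carrier
    ω = (λ₀ · b) · X⁻¹
    ωX≈λb : ω · X ≈ λ₀ · b
    ωX≈λb = begin
      ((λ₀ · b) · X⁻¹) · X  ≈⟨ ·-solve 3 (λ l y z → (l ⊕ y) ⊕ z ⊜ l ⊕ z ⊕ y) refl (λ₀ · b) X⁻¹ X ⟩
      (λ₀ · b) · (X · X⁻¹)  ≈⟨ *-congˡ XX⁻¹≈1 ⟩
      (λ₀ · b) · 1#         ≈⟨ *-identityʳ _ ⟩
      λ₀ · b                ∎

  InV⇔¬InΠ : (∀ {a} → a ≉ 0# → ScaledSquare a) →
    ∀ u → (∃[ ω ] (ω ≉ 0# × InV ω u)) ⇔ (¬ InΠ₁ u × ¬ InΠ₂ u)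
  InV⇔¬InΠ scaled-square u = mk⇔
    (λ (ω , ω≉0 , u∈V) → InV⇒fst≉0 u u∈V ∘ InΠ₁⇒fst≈0 u , InV⇒snd≉0 u ω≉0 u∈V ∘ InΠ₂⇒snd≈0 u)
    (λ (u∉Π₁ , u∉Π₂) →
      nonzero-coords⇒InV scaled-square u (u∉Π₁ ∘ fst≈0⇒InΠ₁ u) (u∉Π₂ ∘ snd≈0⇒InΠ₂ u))

  module _ (square-norm : ∀ {t} → t ≉ 0# → InFq (t ^ᶠ 2) → t ^ᶠ suc q ≈ t ^ᶠ 2) where

    μx²≈λy²⇒μx^[q+1]≈λy^[q+1] : ∀ {x y λ₀ μ} → x ≉ 0# → y ≉ 0# → InFq λ₀ → InFq μ → μ ≉ 0# →
      μ · x ^ᶠ 2 ≈ λ₀ · y ^ᶠ 2 → μ · x ^ᶠ suc q ≈ λ₀ · y ^ᶠ suc q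
    μx²≈λy²⇒μx^[q+1]≈λy^[q+1] {x} {y} {λ₀} {μ} x≉0 y≉0 λ∈Fq μ∈Fq μ≉0 μx²≈λy²
      with inverse y y≉0
    ... | y⁻¹ , yy⁻¹≈1 = begin
      μ · x ^ᶠ suc q              ≈⟨ *-congˡ (^ᶠ-congˡ (suc q) ty≈x) ⟨
      μ · (t · y) ^ᶠ suc q        ≈⟨ *-congˡ (^ᶠ-distrib-· t y (suc q)) ⟩
      μ · (t ^ᶠ suc q · Y)        ≈⟨ *-congˡ (*-congʳ (square-norm t≉0 t²∈Fq)) ⟩
      μ · (t ^ᶠ 2 · Y)            ≈⟨ ·-solve 3 (λ m s z → m ⊕ (s ⊕ z) ⊜ (s ⊕ m) ⊕ z) refl μ (t ^ᶠ 2) Y ⟩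
      (t ^ᶠ 2 · μ) · Y            ≈⟨ *-congʳ t²μ≈λ ⟩
      λ₀ · Y                      ∎
      where
      t : Carrier
      t = x · y⁻¹
      Y : Carrier
      Y = y ^ᶠ suc q

      ty≈x : t · y ≈ x
      ty≈x = trans (*-assoc x y⁻¹ y) (trans (*-congˡ (trans (*-comm y⁻¹ y) yy⁻¹≈1)) (*-identityʳ x))

      t≉0 : t ≉ 0#
      t≉0 = ·-nonzero x≉0 (x·y≈1⇒y≉0 yy⁻¹≈1)

      t²μ≈λ : t ^ᶠ 2 · μ ≈ λ₀
      t²μ≈λ = ·-cancelʳ (^ᶠ-nonzero 2 y≉0) (begin
        (t ^ᶠ 2 · μ) · y ^ᶠ 2       ≈⟨ ·-solve 3 (λ s m z → (s ⊕ m) ⊕ z ⊜ m ⊕ (s ⊕ z)) refl (t ^ᶠ 2) μ (y ^ᶠ 2) ⟩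
        μ · (t ^ᶠ 2 · y ^ᶠ 2)       ≈⟨ *-congˡ (^ᶠ-distrib-· t y 2) ⟨
        μ · (t · y) ^ᶠ 2            ≈⟨ *-congˡ (^ᶠ-congˡ 2 ty≈x) ⟩
        μ · x ^ᶠ 2                  ≈⟨ μx²≈λy² ⟩
        λ₀ · y ^ᶠ 2                 ∎)

      t²∈Fq : InFq (t ^ᶠ 2)
      t²∈Fq = InFq-cancelʳ μ∈Fq μ≉0 (InFq-resp (sym t²μ≈λ) λ∈Fq)

    InV-unique : ∀ {ω ω′} u → InV ω u → InV ω′ u → ω ≈ ω′
    InV-unique {ω} {ω′} (P a b _)
      (x , x≉0 , λ₀ , λ∈Fq , λ≉0 , x²≈λa , ωX≈λb) (y , y≉0 , μ , μ∈Fq , μ≉0 , y²≈μa , ω′Y≈μb) =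
      ·-cancelˡ (·-nonzero λ≉0 (^ᶠ-nonzero (suc q) y≉0)) (begin
        (λ₀ · Y) · ω   ≈⟨ *-congʳ μX≈λY ⟨
        (μ · X) · ω    ≈⟨ ·-solve 3 (λ m z w → (m ⊕ z) ⊕ w ⊜ m ⊕ (w ⊕ z)) refl μ X ω ⟩
        μ · (ω · X)    ≈⟨ *-congˡ ωX≈λb ⟩
        μ · (λ₀ · b)   ≈⟨ ·-solve 3 (λ m l z → m ⊕ (l ⊕ z) ⊜ l ⊕ (m ⊕ z)) refl μ λ₀ b ⟩
        λ₀ · (μ · b)   ≈⟨ *-congˡ ω′Y≈μb ⟨
        λ₀ · (ω′ · Y)  ≈⟨ ·-solve 3 (λ l w z → l ⊕ (w ⊕ z) ⊜ (l ⊕ z) ⊕ w) refl λ₀ ω′ Y ⟩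
        (λ₀ · Y) · ω′  ∎)
      where
      X Y : Carrier
      X = x ^ᶠ suc q
      Y = y ^ᶠ suc q

      μX≈λY : μ · X ≈ λ₀ · Y
      μX≈λY = μx²≈λy²⇒μx^[q+1]≈λy^[q+1] x≉0 y≉0 λ∈Fq μ∈Fq μ≉0 (begin
        μ · x ^ᶠ 2    ≈⟨ *-congˡ x²≈λa ⟩
        μ · (λ₀ · a)  ≈⟨ ·-solve 3 (λ m l z → m ⊕ (l ⊕ z) ⊜ l ⊕ (m ⊕ z)) refl μ λ₀ a ⟩
        λ₀ · (μ · a)  ≈⟨ *-congˡ y²≈μa ⟨
        λ₀ · y ^ᶠ 2   ∎)

module FiniteField {c ℓ} (F : Field c ℓ) (q′ N : ℕ) (card : HasCard F (suc (q′ * N))) where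
  open Field F hiding (_+_) renaming (_*_ to _·_)
  open FieldOps F
  open FieldProperties F
  open PG F (suc q′)
  open Partition F (suc q′)
  open import Relation.Binary.Reasoning.Setoid setoid

  norm∈Fq : ∀ {a} → a ≉ 0# → InFq (a ^ᶠ N)
  norm∈Fq {a} a≉0 = begin
    (a ^ᶠ N) ^ᶠ suc q′        ≈⟨ ^ᶠ-assocʳ a N (suc q′) ⟩
    a ^ᶠ (N * suc q′)         ≡⟨ ≡.cong (a ^ᶠ_) (ℕ.*-suc N q′) ⟩
    a ^ᶠ (N + N * q′)         ≡⟨ ≡.cong (λ k → a ^ᶠ (N + k)) (ℕ.*-comm N q′) ⟩
    a ^ᶠ (N + q′ * N)         ≈⟨ ^ᶠ-homo-· a N (q′ * N) ⟩
    a ^ᶠ N · a ^ᶠ (q′ * N)    ≈⟨ *-congˡ (fermat card a≉0) ⟩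
    a ^ᶠ N · 1#               ≈⟨ *-identityʳ _ ⟩
    a ^ᶠ N                    ∎

  module _ (m : ℕ) (N≡2m+1 : N ≡ 2 * m + 1) where

    square-norm : ∀ {t} → t ≉ 0# → InFq (t ^ᶠ 2) → t ^ᶠ suc (suc q′) ≈ t ^ᶠ 2
    square-norm {t} t≉0 t²∈Fq = begin
      t ^ᶠ (2 + q′)    ≈⟨ ^ᶠ-homo-· t 2 q′ ⟩
      t ^ᶠ 2 · s       ≈⟨ *-congˡ s≈1 ⟩
      t ^ᶠ 2 · 1#      ≈⟨ *-identityʳ _ ⟩
      t ^ᶠ 2           ∎
      where
      s : Carrier
      s = t ^ᶠ q′

      2+q′*2≡2*[1+q′] : 2 + q′ * 2 ≡ 2 * suc q′
      2+q′*2≡2*[1+q′] = solve (q′ ∷ [])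

      s²≈1 : s ^ᶠ 2 ≈ 1#
      s²≈1 = ·-cancelˡ (^ᶠ-nonzero 2 t≉0) (begin
        t ^ᶠ 2 · s ^ᶠ 2        ≈⟨ *-congˡ (^ᶠ-assocʳ t q′ 2) ⟩
        t ^ᶠ 2 · t ^ᶠ (q′ * 2) ≈⟨ ^ᶠ-homo-· t 2 (q′ * 2) ⟨
        t ^ᶠ (2 + q′ * 2)      ≡⟨ ≡.cong (t ^ᶠ_) 2+q′*2≡2*[1+q′] ⟩
        t ^ᶠ (2 * suc q′)      ≈⟨ ^ᶠ-assocʳ t 2 (suc q′) ⟨
        (t ^ᶠ 2) ^ᶠ suc q′     ≈⟨ t²∈Fq ⟩
        t ^ᶠ 2                 ≈⟨ *-identityʳ _ ⟨
        t ^ᶠ 2 · 1#            ∎)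

      s≈1 : s ≈ 1#
      s≈1 = begin
        s                  ≈⟨ x²≈1⇒x^[2m+1]≈x m s²≈1 ⟨
        s ^ᶠ (2 * m + 1)   ≡⟨ ≡.cong (s ^ᶠ_) N≡2m+1 ⟨
        s ^ᶠ N             ≈⟨ ^ᶠ-assocʳ t q′ N ⟩
        t ^ᶠ (q′ * N)      ≈⟨ fermat card t≉0 ⟩
        1#                 ∎

    scaled-square : ∀ {a} → a ≉ 0# → ScaledSquare a
    scaled-square {a} a≉0 = a ^ᶠ suc m , a ^ᶠ N , ^ᶠ-nonzero (suc m) a≉0 , norm∈Fq a≉0 ,
      ^ᶠ-nonzero N a≉0 , (begin
        (a ^ᶠ suc m) ^ᶠ 2   ≈⟨ ^ᶠ-assocʳ a (suc m) 2 ⟩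
        a ^ᶠ (suc m * 2)    ≡⟨ ≡.cong (a ^ᶠ_) [1+m]*2≡2*m+1+1 ⟩
        a ^ᶠ (2 * m + 1 + 1) ≡⟨ ≡.cong (λ k → a ^ᶠ (k + 1)) N≡2m+1 ⟨
        a ^ᶠ (N + 1)        ≈⟨ ^ᶠ-homo-· a N 1 ⟩
        a ^ᶠ N · (a · 1#)   ≈⟨ *-congˡ (*-identityʳ a) ⟩
        a ^ᶠ N · a          ∎)
      where
      [1+m]*2≡2*m+1+1 : suc m * 2 ≡ 2 * m + 1 + 1
      [1+m]*2≡2*m+1+1 = solve (m ∷ [])

-- Only |F| = q^(2n+1) is used (q ≠ 0 because F contains 0#).
lemma3p2 : ∀ {c ℓ : Level} (q n : ℕ) → IsPrimePower q → n ≥ 1 →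
    (F : Field c ℓ) → HasCard F (q ^ (2 * n + 1)) →
    PG.Conclusion F q
lemma3p2 zero n _ _ F card = ⊥-elim (¬Fin0 (≡.subst Fin 0^[2n+1]≡0 (Bijection.to card (Field.0# F))))
  where
  0^[2n+1]≡0 : 0 ^ (2 * n + 1) ≡ 0
  0^[2n+1]≡0 = ≡.cong (0 ^_) (ℕ.+-comm (2 * n) 1)
lemma3p2 (suc q′) n _ _ F card with repunit-odd (suc q′) n
... | m , N≡2m+1 =
  (λ _ _ _ _ → InV-unique (square-norm m N≡2m+1)) , InV⇔¬InΠ (scaled-square m N≡2m+1)
  where
  N : ℕ
  N = repunit (suc q′) (2 * n + 1)

  card′ : HasCard F (suc (q′ * N))
  card′ = ≡.subst (HasCard F) (≡.sym (repunit-geometric q′ (2 * n + 1))) card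

  open Partition F (suc q′)
  open FiniteField F q′ N card′
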